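{- For every positive integer $n$, the graph $\Phi(\mathbb H(\mathbb Z_{2^n}))$ is Hamiltonian.
   Context: $\mathbb H(\mathbb Z_{2^n})$ is the ring of Hamilton quaternions over $\mathbb Z_{2^n}$. Its elements are $a_1+a_2i+a_3j+a_4k$ with $a_i\in\mathbb Z_{2^n}$, written $(a_1,a_2,a_3,a_4)$. Addition is coordinatewise, and multiplication is determined by distributivity, scalars commuting with $i,j,k$, and $i^2=j^2=k^2=-1$, $ij=-ji=k$, $jk=-kj=i$, $ki=-ik=j$. For a ring $R$ with unity, the non-zero divisor graph $\Phi(R)$ is the simple graph with vertex set $R\setminus\{0,1,-1\}$ in which two distinct vertices $x,y$ are adjacent if and only if $xy\neq0$ or $yx\neq0$. A graph is Hamiltonian if it has a cycle through all of its vertices. -}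

module Defs where

open import Data.Nat using (ℕ; zero; suc; _+_; _*_; _∸_; _^_; _≤_; NonZero)
open import Data.Nat.Properties using (m^n≢0)
open import Data.Nat.DivMod using (_mod_)
open import Data.Fin using (Fin; toℕ)
open import Data.List using (List; []; _∷_; _++_; [_]; length)
open import Data.List.Relation.Unary.All using (All)
open import Data.List.Relation.Unary.Unique.Propositional using (Unique)
open import Data.List.Relation.Unary.Linked using (Linked)
open import Data.List.Membership.Propositional using (_∈_)
open import Data.Product using (Σ; _×_)
open import Data.Sum using (_⊎_)
open import Data.Unit using (⊤)
open import Relation.Binary.PropositionalEquality using (_≡_; _≢_)

module ZMod (m : ℕ) .{{_ : NonZero m}} where

  Z : Set
  Z = Fin m

  _+ₘ_ : Z → Z → Z
  a +ₘ b = (toℕ a + toℕ b) mod m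

  _*ₘ_ : Z → Z → Z
  a *ₘ b = (toℕ a * toℕ b) mod m

  -ₘ_ : Z → Z
  -ₘ a = (m ∸ toℕ a) mod m

  0ₘ 1ₘ : Z
  0ₘ = 0 mod m
  1ₘ = 1 mod m

  -- Hamilton quaternions over ℤ_m : a₁ + a₂ i + a₃ j + a₄ k

  record ℍ : Set where
    constructor quat
    field
      a₁ a₂ a₃ a₄ : Z

  0ℍ 1ℍ -1ℍ : ℍ
  0ℍ  = quat 0ₘ 0ₘ 0ₘ 0ₘ
  1ℍ  = quat 1ₘ 0ₘ 0ₘ 0ₘ
  -1ℍ = quat (-ₘ 1ₘ) 0ₘ 0ₘ 0ₘ

  infixl 6 _-ₘ_
  _-ₘ_ : Z → Z → Z
  a -ₘ b = a +ₘ (-ₘ b)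

  -- Hamilton product (i² = j² = k² = -1, ij = k, jk = i, ki = j)
  _*ℍ_ : ℍ → ℍ → ℍ
  quat a₁ a₂ a₃ a₄ *ℍ quat b₁ b₂ b₃ b₄ = quat
    ((((a₁ *ₘ b₁) -ₘ (a₂ *ₘ b₂)) -ₘ (a₃ *ₘ b₃)) -ₘ (a₄ *ₘ b₄))
    ((((a₁ *ₘ b₂) +ₘ (a₂ *ₘ b₁)) +ₘ (a₃ *ₘ b₄)) -ₘ (a₄ *ₘ b₃))
    ((((a₁ *ₘ b₃) -ₘ (a₂ *ₘ b₄)) +ₘ (a₃ *ₘ b₁)) +ₘ (a₄ *ₘ b₂))
    ((((a₁ *ₘ b₄) +ₘ (a₂ *ₘ b₃)) -ₘ (a₃ *ₘ b₂)) +ₘ (a₄ *ₘ b₁))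

  -- The non-zero divisor graph Φ(ℍ(ℤ_m)):
  -- vertices ℍ ∖ {0, 1, -1}; x ~ y iff xy ≠ 0 or yx ≠ 0 (x ≠ y is
  -- enforced by the cycle visiting distinct vertices)

  ΦVertex : ℍ → Set
  ΦVertex x = (x ≢ 0ℍ) × (x ≢ 1ℍ) × (x ≢ -1ℍ)

  ΦAdj : ℍ → ℍ → Set
  ΦAdj x y = ((x *ℍ y) ≢ 0ℍ) ⊎ ((y *ℍ x) ≢ 0ℍ)

ClosedWalk : {A : Set} → (A → A → Set) → List A → Set
ClosedWalk Adj []       = ⊤
ClosedWalk Adj (x ∷ xs) = Linked Adj (x ∷ xs ++ [ x ])

Hamiltonian : {A : Set} → (A → Set) → (A → A → Set) → Set
Hamiltonian {A} Vert Adj =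
  Σ (List A) λ cs →
    All Vert cs × Unique cs × (∀ x → Vert x → x ∈ cs) ×
    (3 ≤ length cs) × ClosedWalk Adj cs

ℍ2^ : ℕ → Set
ℍ2^ n = ZMod.ℍ (2 ^ n) {{m^n≢0 2 n}}

Φℍ2^-Hamiltonian : ℕ → Set
Φℍ2^-Hamiltonian n =
  Hamiltonian (ZMod.ΦVertex (2 ^ n) {{m^n≢0 2 n}}) (ZMod.ΦAdj (2 ^ n) {{m^n≢0 2 n}})

-- Call x ∈ ℍ(ℤ_{2^n}) odd when its coordinate sum is odd. Its norm N(x) = Σ xᵢ² is then odd, hence
-- invertible mod 2^n, and x̄ (x y) = N(x) y shows that x y = 0 forces y = 0: an odd element is
-- adjacent to every other vertex. Adding 1 swaps the two parity classes and sends 0 to 1 and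
-- s = -2 to -1, so the vertices are s, the nonzero even x ≠ s, and their successors x + 1.
-- Listing those even x as y₀, x₁, …, x_r with y₀ = 1 + i, the cycle
--   s, y₀, y₀ + 1, x₁, x₁ + 1, …, x_r, x_r + 1
-- has an odd end on every edge except s y₀, and s y₀ = -2 - 2i ≠ 0 once 2^n ≥ 4.
-- For 2^n = 2 we have s = 0, and the pairs x, x + 1 alone close up.

module Submission where

open import Defs
open import Data.Nat as ℕ using (ℕ; zero; suc; _≤_; _<_; _^_; NonZero; z≤n; s≤s)
import Data.Nat.Properties as ℕP
open import Data.Nat.DivMod using (_mod_; _%_; _/_; m≡m%n+[m/n]*n; m%n<n; %-distribˡ-+; %-distribˡ-*; m∣n⇒o%n%m≡o%m; m<n⇒m%n≡m)
import Data.Nat.Divisibility as ℕ∣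
open import Data.Nat.Primality using (Prime; euclidsLemma; prime⇒nonZero; prime[2])
open import Data.Fin using (toℕ)
import Data.Fin.Properties as Fin
open import Data.Integer using (ℤ; +_; _+_; _*_; -_; _-_; _⊖_; ∣_∣)
import Data.Integer.Properties as ℤP
open import Data.Integer.Divisibility.Signed using (_∣_; divides; ∣m∣n⇒∣m+n; ∣m∣n⇒∣m-n; ∣m⇒∣-m; ∣n⇒∣m*n; ∣⇒∣ᵤ; ∣-refl)
open import Data.Integer.Tactic.RingSolver using (solve-∀)
open import Data.List using (List; []; _∷_; _++_; [_]; filter; cartesianProduct; cartesianProductWith; allFin)
open import Data.List.Relation.Unary.All as All using (All; []; _∷_; all?)
open import Data.List.Relation.Unary.Any using (here; there)
open import Data.List.Relation.Unary.Linked using (Linked; [-]; _∷_; linked?)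
open import Data.List.Relation.Unary.AllPairs using ([]; _∷_)
open import Data.List.Relation.Unary.Unique.Propositional using (Unique)
import Data.List.Relation.Unary.Unique.Propositional.Properties as Unique
open import Data.List.Membership.Propositional using (_∈_)
import Data.List.Membership.Propositional.Properties as ∈
open import Data.Product using (∃-syntax; _×_; _,_; proj₁; proj₂)
open import Data.Sum using (_⊎_; inj₁; inj₂)
import Data.Sum as Sum
open import Function using (_∘_)
open import Relation.Nullary using (¬_; Dec; yes; no; ¬?; contradiction)
open import Relation.Nullary.Decidable using (_×-dec_; _⊎-dec_; from-yes)
import Relation.Nullary.Decidable as Dec
open import Data.Unit using (tt)
open import Relation.Unary using (Decidable)
open import Relation.Binary.Definitions using (DecidableEquality)
open import Relation.Binary.PropositionalEquality hiding ([_])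

∣∧<⇒≡0 : ∀ {m n} → m ℕ∣.∣ n → n < m → n ≡ 0
∣∧<⇒≡0 {n = zero}  _   _   = refl
∣∧<⇒≡0 {n = suc _} m∣n n<m = contradiction m∣n (ℕ∣.>⇒∤ n<m)

prime^∣-cancelˡ : ∀ {p} → Prime p → ∀ j {a b} → ¬ p ℕ∣.∣ a → p ^ j ℕ∣.∣ a ℕ.* b → p ^ j ℕ∣.∣ b
prime^∣-cancelˡ _ zero _ _ = ℕ∣.1∣ _
prime^∣-cancelˡ {p} pp (suc j) {a} {b} p∤a pʲ⁺¹∣ab
  with euclidsLemma a b pp (ℕ∣.∣-trans (ℕ∣.m∣m*n (p ^ j)) pʲ⁺¹∣ab)
... | inj₁ p∣a = contradiction p∣a p∤a
... | inj₂ (ℕ∣.divides-refl c) = subst (p ^ suc j ℕ∣.∣_) (ℕP.*-comm p c) (ℕ∣.*-monoʳ-∣ p pʲ∣c)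
  where
  instance _ = prime⇒nonZero pp
  pʲ∣c : p ^ j ℕ∣.∣ c
  pʲ∣c = prime^∣-cancelˡ pp j p∤a (ℕ∣.*-cancelˡ-∣ p
    (subst (p ^ suc j ℕ∣.∣_) (trans (sym (ℕP.*-assoc a c p)) (ℕP.*-comm (a ℕ.* c) p)) pʲ⁺¹∣ab))

%-+-cong : ∀ k .{{_ : NonZero k}} a b c d → a % k ≡ c % k → b % k ≡ d % k → (a ℕ.+ b) % k ≡ (c ℕ.+ d) % k
%-+-cong k a b c d a≡c b≡d = begin
  (a ℕ.+ b) % k           ≡⟨ %-distribˡ-+ a b k ⟩
  (a % k ℕ.+ b % k) % k   ≡⟨ cong₂ (λ u v → (u ℕ.+ v) % k) a≡c b≡d ⟩
  (c % k ℕ.+ d % k) % k   ≡⟨ %-distribˡ-+ c d k ⟨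
  (c ℕ.+ d) % k           ∎
  where open ≡-Reasoning

%-+₄-cong : ∀ k .{{_ : NonZero k}} a b c d a′ b′ c′ d′ →
            a % k ≡ a′ % k → b % k ≡ b′ % k → c % k ≡ c′ % k → d % k ≡ d′ % k →
            (a ℕ.+ b ℕ.+ c ℕ.+ d) % k ≡ (a′ ℕ.+ b′ ℕ.+ c′ ℕ.+ d′) % k
%-+₄-cong k a b c d a′ b′ c′ d′ p q r t =
  %-+-cong k (a ℕ.+ b ℕ.+ c) d (a′ ℕ.+ b′ ℕ.+ c′) d′
    (%-+-cong k (a ℕ.+ b) c (a′ ℕ.+ b′) c′ (%-+-cong k a b a′ b′ p q) r) t

%2-dichotomy : ∀ n → n % 2 ≡ 0 ⊎ n % 2 ≡ 1
%2-dichotomy n with n % 2 | m%n<n n 2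
... | 0 | _ = inj₁ refl
... | 1 | _ = inj₂ refl
... | suc (suc _) | s≤s (s≤s ())

n*n%2≡n%2 : ∀ n → n ℕ.* n % 2 ≡ n % 2
n*n%2≡n%2 n with n % 2 | %-distribˡ-* n n 2 | %2-dichotomy n
... | _ | n²%2 | inj₁ refl = n²%2
... | _ | n²%2 | inj₂ refl = n²%2

record ℍℤ : Set where
  constructor ⟨_,_,_,_⟩
  field
    q₁ q₂ q₃ q₄ : ℤ

infixl 7 _·_
infixr 7 _⊙_

_·_ : ℍℤ → ℍℤ → ℍℤ
⟨ a₁ , a₂ , a₃ , a₄ ⟩ · ⟨ b₁ , b₂ , b₃ , b₄ ⟩ = ⟨
  a₁ * b₁ - a₂ * b₂ - a₃ * b₃ - a₄ * b₄ ,
  a₁ * b₂ + a₂ * b₁ + a₃ * b₄ - a₄ * b₃ ,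
  a₁ * b₃ - a₂ * b₄ + a₃ * b₁ + a₄ * b₂ ,
  a₁ * b₄ + a₂ * b₃ - a₃ * b₂ + a₄ * b₁ ⟩

_⊙_ : ℤ → ℍℤ → ℍℤ
c ⊙ ⟨ a₁ , a₂ , a₃ , a₄ ⟩ = ⟨ c * a₁ , c * a₂ , c * a₃ , c * a₄ ⟩

conj : ℍℤ → ℍℤ
conj ⟨ a₁ , a₂ , a₃ , a₄ ⟩ = ⟨ a₁ , - a₂ , - a₃ , - a₄ ⟩

norm : ℍℤ → ℤ
norm ⟨ a₁ , a₂ , a₃ , a₄ ⟩ = a₁ * a₁ + a₂ * a₂ + a₃ * a₃ + a₄ * a₄

⟨⟩-cong : ∀ {a b c d a′ b′ c′ d′} → a ≡ a′ → b ≡ b′ → c ≡ c′ → d ≡ d′ →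
          ⟨ a , b , c , d ⟩ ≡ ⟨ a′ , b′ , c′ , d′ ⟩
⟨⟩-cong refl refl refl refl = refl

conj-·-· : ∀ a y → conj a · (a · y) ≡ norm a ⊙ y
conj-·-· ⟨ a₁ , a₂ , a₃ , a₄ ⟩ ⟨ y₁ , y₂ , y₃ , y₄ ⟩ =
  ⟨⟩-cong (coord₁ a₁ a₂ a₃ a₄ y₁ y₂ y₃ y₄) (coord₂ a₁ a₂ a₃ a₄ y₁ y₂ y₃ y₄)
          (coord₃ a₁ a₂ a₃ a₄ y₁ y₂ y₃ y₄) (coord₄ a₁ a₂ a₃ a₄ y₁ y₂ y₃ y₄)
  where
  coord₁ : ∀ a₁ a₂ a₃ a₄ y₁ y₂ y₃ y₄ →
    a₁ * (a₁ * y₁ - a₂ * y₂ - a₃ * y₃ - a₄ * y₄) - - a₂ * (a₁ * y₂ + a₂ * y₁ + a₃ * y₄ - a₄ * y₃)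
      - - a₃ * (a₁ * y₃ - a₂ * y₄ + a₃ * y₁ + a₄ * y₂) - - a₄ * (a₁ * y₄ + a₂ * y₃ - a₃ * y₂ + a₄ * y₁)
    ≡ (a₁ * a₁ + a₂ * a₂ + a₃ * a₃ + a₄ * a₄) * y₁
  coord₁ = solve-∀
  coord₂ : ∀ a₁ a₂ a₃ a₄ y₁ y₂ y₃ y₄ →
    a₁ * (a₁ * y₂ + a₂ * y₁ + a₃ * y₄ - a₄ * y₃) + - a₂ * (a₁ * y₁ - a₂ * y₂ - a₃ * y₃ - a₄ * y₄)
      + - a₃ * (a₁ * y₄ + a₂ * y₃ - a₃ * y₂ + a₄ * y₁) - - a₄ * (a₁ * y₃ - a₂ * y₄ + a₃ * y₁ + a₄ * y₂)
    ≡ (a₁ * a₁ + a₂ * a₂ + a₃ * a₃ + a₄ * a₄) * y₂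
  coord₂ = solve-∀
  coord₃ : ∀ a₁ a₂ a₃ a₄ y₁ y₂ y₃ y₄ →
    a₁ * (a₁ * y₃ - a₂ * y₄ + a₃ * y₁ + a₄ * y₂) - - a₂ * (a₁ * y₄ + a₂ * y₃ - a₃ * y₂ + a₄ * y₁)
      + - a₃ * (a₁ * y₁ - a₂ * y₂ - a₃ * y₃ - a₄ * y₄) + - a₄ * (a₁ * y₂ + a₂ * y₁ + a₃ * y₄ - a₄ * y₃)
    ≡ (a₁ * a₁ + a₂ * a₂ + a₃ * a₃ + a₄ * a₄) * y₃
  coord₃ = solve-∀
  coord₄ : ∀ a₁ a₂ a₃ a₄ y₁ y₂ y₃ y₄ →
    a₁ * (a₁ * y₄ + a₂ * y₃ - a₃ * y₂ + a₄ * y₁) + - a₂ * (a₁ * y₃ - a₂ * y₄ + a₃ * y₁ + a₄ * y₂)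
      - - a₃ * (a₁ * y₂ + a₂ * y₁ + a₃ * y₄ - a₄ * y₃) + - a₄ * (a₁ * y₁ - a₂ * y₂ - a₃ * y₃ - a₄ * y₄)
    ≡ (a₁ * a₁ + a₂ * a₂ + a₃ * a₃ + a₄ * a₄) * y₄
  coord₄ = solve-∀

infix 4 _∣ᴴ_

record _∣ᴴ_ (k : ℤ) (a : ℍℤ) : Set where
  constructor coordinatewise
  field
    ∣q₁ : k ∣ ℍℤ.q₁ a
    ∣q₂ : k ∣ ℍℤ.q₂ a
    ∣q₃ : k ∣ ℍℤ.q₃ a
    ∣q₄ : k ∣ ℍℤ.q₄ a

∣ᴴ-·ˡ : ∀ {k} a {b} → k ∣ᴴ b → k ∣ᴴ a · b
∣ᴴ-·ˡ ⟨ a₁ , a₂ , a₃ , a₄ ⟩ (coordinatewise d₁ d₂ d₃ d₄) = coordinatewise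
  (∣m∣n⇒∣m-n (∣m∣n⇒∣m-n (∣m∣n⇒∣m-n (∣n⇒∣m*n a₁ d₁) (∣n⇒∣m*n a₂ d₂)) (∣n⇒∣m*n a₃ d₃)) (∣n⇒∣m*n a₄ d₄))
  (∣m∣n⇒∣m-n (∣m∣n⇒∣m+n (∣m∣n⇒∣m+n (∣n⇒∣m*n a₁ d₂) (∣n⇒∣m*n a₂ d₁)) (∣n⇒∣m*n a₃ d₄)) (∣n⇒∣m*n a₄ d₃))
  (∣m∣n⇒∣m+n (∣m∣n⇒∣m+n (∣m∣n⇒∣m-n (∣n⇒∣m*n a₁ d₃) (∣n⇒∣m*n a₂ d₄)) (∣n⇒∣m*n a₃ d₁)) (∣n⇒∣m*n a₄ d₂))
  (∣m∣n⇒∣m+n (∣m∣n⇒∣m-n (∣m∣n⇒∣m+n (∣n⇒∣m*n a₁ d₄) (∣n⇒∣m*n a₂ d₃)) (∣n⇒∣m*n a₃ d₂)) (∣n⇒∣m*n a₄ d₁))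

module Congruence (m : ℕ) where

  infix 4 _≈_ _≋_

  record _≈_ (x y : ℤ) : Set where
    constructor mk≈
    field
      ∣-difference : + m ∣ x - y

  private
    ≈-by : ∀ {x y z} → z ≡ x - y → + m ∣ z → x ≈ y
    ≈-by refl m∣z = mk≈ m∣z

    sym-diff : ∀ x y → - (x - y) ≡ y - x
    sym-diff = solve-∀
    trans-diff : ∀ x y z → (x - y) + (y - z) ≡ x - z
    trans-diff = solve-∀
    +-diff : ∀ x₁ x₂ y₁ y₂ → (x₁ - y₁) + (x₂ - y₂) ≡ (x₁ + x₂) - (y₁ + y₂)
    +-diff = solve-∀
    neg-diff : ∀ x y → - (x - y) ≡ - x - - y
    neg-diff = solve-∀
    multiple-diff : ∀ x q k → x + q * k - x ≡ q * k
    multiple-diff = solve-∀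

  ≈-refl : ∀ {x} → x ≈ x
  ≈-refl {x} = ≈-by (sym (ℤP.+-inverseʳ x)) (divides (+ 0) refl)

  ≈-reflexive : ∀ {x y} → x ≡ y → x ≈ y
  ≈-reflexive refl = ≈-refl

  ≈-sym : ∀ {x y} → x ≈ y → y ≈ x
  ≈-sym {x} {y} (mk≈ p) = ≈-by (sym-diff x y) (∣m⇒∣-m p)

  ≈-trans : ∀ {x y z} → x ≈ y → y ≈ z → x ≈ z
  ≈-trans {x} {y} {z} (mk≈ p) (mk≈ q) = ≈-by (trans-diff x y z) (∣m∣n⇒∣m+n p q)

  +-cong : ∀ {x₁ x₂ y₁ y₂} → x₁ ≈ y₁ → x₂ ≈ y₂ → x₁ + x₂ ≈ y₁ + y₂
  +-cong {x₁} {x₂} {y₁} {y₂} (mk≈ p) (mk≈ q) = ≈-by (+-diff x₁ x₂ y₁ y₂) (∣m∣n⇒∣m+n p q)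

  neg-cong : ∀ {x y} → x ≈ y → - x ≈ - y
  neg-cong {x} {y} (mk≈ p) = ≈-by (neg-diff x y) (∣m⇒∣-m p)

  +-multiple : ∀ x q → x + q * + m ≈ x
  +-multiple x q = ≈-by (sym (multiple-diff x q (+ m))) (∣n⇒∣m*n q ∣-refl)

  0≈⇒∣ : ∀ {x} → + 0 ≈ x → + m ∣ x
  0≈⇒∣ {x} (mk≈ p) = subst (+ m ∣_) (trans (cong -_ (ℤP.+-identityˡ (- x))) (ℤP.neg-involutive x)) (∣m⇒∣-m p)

  ∣∧small⇒≡0 : ∀ {z} → + m ∣ z → ∣ z ∣ < m → z ≡ + 0
  ∣∧small⇒≡0 m∣z small = ℤP.∣i∣≡0⇒i≡0 (∣∧<⇒≡0 (∣⇒∣ᵤ m∣z) small)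

  record _≋_ (a b : ℍℤ) : Set where
    field
      ≈q₁ : ℍℤ.q₁ a ≈ ℍℤ.q₁ b
      ≈q₂ : ℍℤ.q₂ a ≈ ℍℤ.q₂ b
      ≈q₃ : ℍℤ.q₃ a ≈ ℍℤ.q₃ b
      ≈q₄ : ℍℤ.q₄ a ≈ ℍℤ.q₄ b

-- ℍ(ℤ_m) inside ℍℤ, up to congruence modulo m

module Reduction (m : ℕ) .{{_ : NonZero m}} where

  open ZMod m
  open ℍ
  open Congruence m

  ι : Z → ℤ
  ι a = + toℕ a

  toℕ-mod : ∀ x → toℕ (x mod m) ≡ x % m
  toℕ-mod x = Fin.toℕ-fromℕ< (m%n<n x m)

  ι-mod : ∀ x → ι (x mod m) ≈ + x
  ι-mod x = ≈-sym (subst (_≈ ι (x mod m)) (sym x≡) (+-multiple (ι (x mod m)) (+ (x / m))))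
    where
    open ≡-Reasoning
    x≡ : + x ≡ ι (x mod m) + + (x / m) * + m
    x≡ = begin
      + x                               ≡⟨ cong +_ (m≡m%n+[m/n]*n x m) ⟩
      + (x % m ℕ.+ x / m ℕ.* m)         ≡⟨ ℤP.pos-+ (x % m) (x / m ℕ.* m) ⟩
      + (x % m) + + (x / m ℕ.* m)       ≡⟨ cong₂ _+_ (cong +_ (sym (toℕ-mod x))) (ℤP.pos-* (x / m) m) ⟩
      ι (x mod m) + + (x / m) * + m     ∎

  ι-+ : ∀ {a b X Y} → ι a ≈ X → ι b ≈ Y → ι (a +ₘ b) ≈ X + Y
  ι-+ {a} {b} p q = ≈-trans (ι-mod (toℕ a ℕ.+ toℕ b))
    (≈-trans (≈-reflexive (ℤP.pos-+ (toℕ a) (toℕ b))) (+-cong p q))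

  ι-* : ∀ a b → ι (a *ₘ b) ≈ ι a * ι b
  ι-* a b = ≈-trans (ι-mod (toℕ a ℕ.* toℕ b)) (≈-reflexive (ℤP.pos-* (toℕ a) (toℕ b)))

  ι-neg : ∀ {a X} → ι a ≈ X → ι (-ₘ a) ≈ - X
  ι-neg {a} p = ≈-trans (ι-mod (m ℕ.∸ toℕ a))
    (≈-trans (≈-reflexive m∸a≡) (≈-trans (+-multiple (- ι a) (+ 1)) (neg-cong p)))
    where
    m-x : ∀ x k → k - x ≡ - x + + 1 * k
    m-x = solve-∀
    m∸a≡ : + (m ℕ.∸ toℕ a) ≡ - ι a + + 1 * + m
    m∸a≡ = trans (sym (ℤP.⊖-≥ (ℕP.<⇒≤ (Fin.toℕ<n a)))) (trans (sym (ℤP.[+m]-[+n]≡m⊖n m (toℕ a))) (m-x (ι a) (+ m)))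

  ι-- : ∀ {a b X Y} → ι a ≈ X → ι b ≈ Y → ι (a -ₘ b) ≈ X - Y
  ι-- p q = ι-+ p (ι-neg q)

  toℕ-0ₘ : toℕ 0ₘ ≡ 0
  toℕ-0ₘ = trans (toℕ-mod 0) (m<n⇒m%n≡m (ℕ.>-nonZero⁻¹ m))

  toℕ-1ₘ : 1 < m → toℕ 1ₘ ≡ 1
  toℕ-1ₘ 1<m = trans (toℕ-mod 1) (m<n⇒m%n≡m 1<m)

  ι-0 : ι 0ₘ ≡ + 0
  ι-0 = cong +_ toℕ-0ₘ

  ι-injective : ∀ {a b} → ι a ≈ ι b → a ≡ b
  ι-injective {a} {b} (mk≈ m∣a-b) =
    Fin.toℕ-injective (ℤP.+-injective (ℤP.i-j≡0⇒i≡j (ι a) (ι b) (∣∧small⇒≡0 m∣a-b small)))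
    where
    open ℕP.≤-Reasoning
    small : ∣ ι a - ι b ∣ < m
    small = begin-strict
      ∣ ι a - ι b ∣            ≡⟨ cong ∣_∣ (ℤP.[+m]-[+n]≡m⊖n (toℕ a) (toℕ b)) ⟩
      ∣ toℕ a ⊖ toℕ b ∣        ≤⟨ ℤP.∣m⊝n∣≤m⊔n (toℕ a) (toℕ b) ⟩
      toℕ a ℕ.⊔ toℕ b          <⟨ ℕP.⊔-lub (Fin.toℕ<n a) (Fin.toℕ<n b) ⟩
      m                        ∎

  quat-≡ : ∀ {x y} → a₁ x ≡ a₁ y → a₂ x ≡ a₂ y → a₃ x ≡ a₃ y → a₄ x ≡ a₄ y → x ≡ y
  quat-≡ refl refl refl refl = refl

  lift : ℍ → ℍℤ
  lift x = ⟨ ι (a₁ x) , ι (a₂ x) , ι (a₃ x) , ι (a₄ x) ⟩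

  lift-*ℍ : ∀ x y → lift (x *ℍ y) ≋ lift x · lift y
  lift-*ℍ (quat a₁ a₂ a₃ a₄) (quat b₁ b₂ b₃ b₄) = record
    { ≈q₁ = ι-- (ι-- (ι-- (ι-* a₁ b₁) (ι-* a₂ b₂)) (ι-* a₃ b₃)) (ι-* a₄ b₄)
    ; ≈q₂ = ι-- (ι-+ (ι-+ (ι-* a₁ b₂) (ι-* a₂ b₁)) (ι-* a₃ b₄)) (ι-* a₄ b₃)
    ; ≈q₃ = ι-+ (ι-+ (ι-- (ι-* a₁ b₃) (ι-* a₂ b₄)) (ι-* a₃ b₁)) (ι-* a₄ b₂)
    ; ≈q₄ = ι-+ (ι-- (ι-+ (ι-* a₁ b₄) (ι-* a₂ b₃)) (ι-* a₃ b₂)) (ι-* a₄ b₁)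
    }

  *ℍ≡0⇒∣ᴴ : ∀ {x y} → x *ℍ y ≡ 0ℍ → + m ∣ᴴ lift x · lift y
  *ℍ≡0⇒∣ᴴ {x} {y} xy≡0 = coordinatewise
    (vanishes (cong a₁ xy≡0) ≈q₁) (vanishes (cong a₂ xy≡0) ≈q₂)
    (vanishes (cong a₃ xy≡0) ≈q₃) (vanishes (cong a₄ xy≡0) ≈q₄)
    where
    open _≋_ (lift-*ℍ x y)
    vanishes : ∀ {a c} → a ≡ 0ₘ → ι a ≈ c → + m ∣ c
    vanishes {c = c} refl p = 0≈⇒∣ (subst (_≈ c) ι-0 p)

  weight : ℍ → ℕ
  weight x = toℕ (a₁ x) ℕ.+ toℕ (a₂ x) ℕ.+ toℕ (a₃ x) ℕ.+ toℕ (a₄ x)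

  record Even (x : ℍ) : Set where
    constructor even
    field weight-even : weight x % 2 ≡ 0

  record Odd (x : ℍ) : Set where
    constructor odd
    field weight-odd : weight x % 2 ≡ 1

  even? : Decidable Even
  even? x = Dec.map′ even Even.weight-even (weight x % 2 ℕ.≟ 0)

  even-or-odd : ∀ x → Even x ⊎ Odd x
  even-or-odd x = Sum.map even odd (%2-dichotomy (weight x))

  even≢odd : ∀ {x y} → Even x → Odd y → x ≢ y
  even≢odd (even e) (odd o) refl = ℕP.0≢1+n (trans (sym e) o)

  even-0ℍ : Even 0ℍ
  even-0ℍ = even (cong (λ z → (z ℕ.+ z ℕ.+ z ℕ.+ z) % 2) toℕ-0ₘ)

  private
    square : Z → ℕ
    square a = toℕ a ℕ.* toℕ a

  normℕ : ℍ → ℕ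
  normℕ x = square (a₁ x) ℕ.+ square (a₂ x) ℕ.+ square (a₃ x) ℕ.+ square (a₄ x)

  norm-lift : ∀ x → norm (lift x) ≡ + normℕ x
  norm-lift x = sym (trans (ℤP.pos-+ _ (square (a₄ x))) (cong₂ _+_
    (trans (ℤP.pos-+ _ (square (a₃ x))) (cong₂ _+_
      (trans (ℤP.pos-+ (square (a₁ x)) (square (a₂ x))) (cong₂ _+_ (pos-square (a₁ x)) (pos-square (a₂ x))))
      (pos-square (a₃ x))))
    (pos-square (a₄ x))))
    where
    pos-square : ∀ a → + square a ≡ ι a * ι a
    pos-square a = ℤP.pos-* (toℕ a) (toℕ a)

  normℕ≡weight-mod-2 : ∀ x → normℕ x % 2 ≡ weight x % 2
  normℕ≡weight-mod-2 (quat x₁ x₂ x₃ x₄) =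
    %-+₄-cong 2 (square x₁) (square x₂) (square x₃) (square x₄) (toℕ x₁) (toℕ x₂) (toℕ x₃) (toℕ x₄)
      (n*n%2≡n%2 (toℕ x₁)) (n*n%2≡n%2 (toℕ x₂)) (n*n%2≡n%2 (toℕ x₃)) (n*n%2≡n%2 (toℕ x₄))

  incr decr : ℍ → ℍ
  incr x = record x { a₁ = a₁ x +ₘ 1ₘ }
  decr x = record x { a₁ = a₁ x -ₘ 1ₘ }

  private
    sub-add : ∀ x y → x - y + y ≡ x
    sub-add = solve-∀
    add-sub : ∀ x y → x + y - y ≡ x
    add-sub = solve-∀

  incr-decr : ∀ x → incr (decr x) ≡ x
  incr-decr x = cong (λ c → record x { a₁ = c })
    (ι-injective (≈-trans (ι-+ {a₁ x -ₘ 1ₘ} (ι-- {a₁ x} {1ₘ} ≈-refl ≈-refl) (≈-refl {ι 1ₘ}))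
                          (≈-reflexive (sub-add (ι (a₁ x)) (ι 1ₘ)))))

  decr-incr : ∀ x → decr (incr x) ≡ x
  decr-incr x = cong (λ c → record x { a₁ = c })
    (ι-injective (≈-trans (ι-- {a₁ x +ₘ 1ₘ} (ι-+ {a₁ x} {1ₘ} ≈-refl ≈-refl) (≈-refl {ι 1ₘ}))
                          (≈-reflexive (add-sub (ι (a₁ x)) (ι 1ₘ)))))

  incr-injective : ∀ {x y} → incr x ≡ incr y → x ≡ y
  incr-injective {x} {y} e = trans (sym (decr-incr x)) (trans (cong decr e) (decr-incr y))

  incr-0ℍ : incr 0ℍ ≡ 1ℍ
  incr-0ℍ = cong (λ c → quat c 0ₘ 0ₘ 0ₘ)
    (ι-injective (≈-trans (ι-+ {0ₘ} {1ₘ} (≈-reflexive ι-0) ≈-refl) (≈-reflexive (ℤP.+-identityˡ (ι 1ₘ)))))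

  incr--1ℍ : incr -1ℍ ≡ 0ℍ
  incr--1ℍ = cong (λ c → quat c 0ₘ 0ₘ 0ₘ)
    (ι-injective (≈-trans (ι-+ { -ₘ 1ₘ } {1ₘ} (ι-neg {1ₘ} ≈-refl) ≈-refl)
                          (≈-reflexive (trans (ℤP.+-inverseˡ (ι 1ₘ)) (sym ι-0)))))

  module _ (2∣m : 2 ℕ∣.∣ m) where

    weight-incr : ∀ x → weight (incr x) % 2 ≡ (1 ℕ.+ weight x % 2) % 2
    weight-incr x@(quat x₁ x₂ x₃ x₄) = trans
      (%-+₄-cong 2 (toℕ (x₁ +ₘ 1ₘ)) (toℕ x₂) (toℕ x₃) (toℕ x₄) (suc (toℕ x₁)) (toℕ x₂) (toℕ x₃) (toℕ x₄)
         first refl refl refl)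
      (%-distribˡ-+ 1 (weight x) 2)
      where
      open ≡-Reasoning
      mod-m-mod-2 : ∀ o → o % m % 2 ≡ o % 2
      mod-m-mod-2 o = m∣n⇒o%n%m≡o%m 2 m o 2∣m
      first : toℕ (x₁ +ₘ 1ₘ) % 2 ≡ suc (toℕ x₁) % 2
      first = begin
        toℕ (x₁ +ₘ 1ₘ) % 2                 ≡⟨ cong (_% 2) (toℕ-mod (toℕ x₁ ℕ.+ toℕ 1ₘ)) ⟩
        (toℕ x₁ ℕ.+ toℕ 1ₘ) % m % 2         ≡⟨ mod-m-mod-2 (toℕ x₁ ℕ.+ toℕ 1ₘ) ⟩
        (toℕ x₁ ℕ.+ toℕ 1ₘ) % 2             ≡⟨ %-+-cong 2 (toℕ x₁) (toℕ 1ₘ) (toℕ x₁) 1 refl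
                                                 (trans (cong (_% 2) (toℕ-mod 1)) (mod-m-mod-2 1)) ⟩
        (toℕ x₁ ℕ.+ 1) % 2                  ≡⟨ cong (_% 2) (ℕP.+-comm (toℕ x₁) 1) ⟩
        suc (toℕ x₁) % 2                    ∎

    even⇒odd-incr : ∀ {x} → Even x → Odd (incr x)
    even⇒odd-incr {x} (even e) = odd (trans (weight-incr x) (cong (λ r → (1 ℕ.+ r) % 2) e))

    odd⇒even-incr : ∀ {x} → Odd x → Even (incr x)
    odd⇒even-incr {x} (odd o) = even (trans (weight-incr x) (cong (λ r → (1 ℕ.+ r) % 2) o))

    odd-incr⇒even : ∀ {x} → Odd (incr x) → Even x
    odd-incr⇒even {x} od with even-or-odd x
    ... | inj₁ ev = ev
    ... | inj₂ od′ = contradiction refl (even≢odd (odd⇒even-incr od′) od)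

    even-incr⇒odd : ∀ {x} → Even (incr x) → Odd x
    even-incr⇒odd {x} ev with even-or-odd x
    ... | inj₁ ev′ = contradiction refl (even≢odd ev (even⇒odd-incr ev′))
    ... | inj₂ od = od

    odd-1ℍ : Odd 1ℍ
    odd-1ℍ = subst Odd incr-0ℍ (even⇒odd-incr even-0ℍ)

    odd--1ℍ : Odd -1ℍ
    odd--1ℍ = even-incr⇒odd (subst Even (sym incr--1ℍ) even-0ℍ)

module PowerOfTwo (n : ℕ) where

  private
    m : ℕ
    m = 2 ^ n
    instance
      _ = ℕP.m^n≢0 2 n

  open ZMod m
  open ℍ
  open Congruence m
  open Reduction m

  odd-*-∣⇒≡0ₘ : ∀ {N} a → N % 2 ≡ 1 → + m ∣ + N * ι a → a ≡ 0ₘ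
  odd-*-∣⇒≡0ₘ {N} a N-odd m∣Na = Fin.toℕ-injective (trans (∣∧<⇒≡0 m∣a (Fin.toℕ<n a)) (sym toℕ-0ₘ))
    where
    2∤N : ¬ 2 ℕ∣.∣ N
    2∤N 2∣N = ℕP.0≢1+n (trans (sym (ℕ∣.n∣m⇒m%n≡0 N 2 2∣N)) N-odd)
    m∣a : m ℕ∣.∣ toℕ a
    m∣a = prime^∣-cancelˡ prime[2] n 2∤N (subst (m ℕ∣.∣_) (ℤP.abs-* (+ N) (ι a)) (∣⇒∣ᵤ m∣Na))

  odd-cancelˡ : ∀ {u y} → Odd u → u *ℍ y ≡ 0ℍ → y ≡ 0ℍ
  odd-cancelˡ {u} {y} (odd u-odd) uy≡0 = quat-≡ (cancel _ ∣q₁) (cancel _ ∣q₂) (cancel _ ∣q₃) (cancel _ ∣q₄)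
    where
    m∣ūuy : + m ∣ᴴ conj (lift u) · (lift u · lift y)
    m∣ūuy = ∣ᴴ-·ˡ (conj (lift u)) (*ℍ≡0⇒∣ᴴ {u} {y} uy≡0)
    m∣Ny : + m ∣ᴴ + normℕ u ⊙ lift y
    m∣Ny = subst (+ m ∣ᴴ_) (trans (conj-·-· (lift u) (lift y)) (cong (_⊙ lift y) (norm-lift u))) m∣ūuy
    open _∣ᴴ_ m∣Ny
    cancel : ∀ a → + m ∣ + normℕ u * ι a → a ≡ 0ₘ
    cancel a = odd-*-∣⇒≡0ₘ {normℕ u} a (trans (normℕ≡weight-mod-2 u) u-odd)

  odd-adjacentˡ : ∀ {u y} → Odd u → y ≢ 0ℍ → ΦAdj u y
  odd-adjacentˡ u-odd y≢0 = inj₁ (y≢0 ∘ odd-cancelˡ u-odd)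

  odd-adjacentʳ : ∀ {u y} → Odd u → y ≢ 0ℍ → ΦAdj y u
  odd-adjacentʳ u-odd y≢0 = inj₂ (y≢0 ∘ odd-cancelˡ u-odd)

module _ {A : Set} (f : A → A) where

  interleave : List A → List A
  interleave []       = []
  interleave (x ∷ xs) = x ∷ f x ∷ interleave xs

  ∈-interleave⁺ˡ : ∀ {v xs} → v ∈ xs → v ∈ interleave xs
  ∈-interleave⁺ˡ (here refl) = here refl
  ∈-interleave⁺ˡ (there v∈)  = there (there (∈-interleave⁺ˡ v∈))

  ∈-interleave⁺ʳ : ∀ {v xs} → v ∈ xs → f v ∈ interleave xs
  ∈-interleave⁺ʳ (here refl) = there (here refl)
  ∈-interleave⁺ʳ (there v∈)  = there (there (∈-interleave⁺ʳ v∈))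

  ∈-interleave⁻ : ∀ {v} xs → v ∈ interleave xs → v ∈ xs ⊎ ∃[ z ] (z ∈ xs × v ≡ f z)
  ∈-interleave⁻ (x ∷ xs) (here refl)         = inj₁ (here refl)
  ∈-interleave⁻ (x ∷ xs) (there (here refl)) = inj₂ (x , here refl , refl)
  ∈-interleave⁻ (x ∷ xs) (there (there v∈)) with ∈-interleave⁻ xs v∈
  ... | inj₁ v∈xs            = inj₁ (there v∈xs)
  ... | inj₂ (z , z∈xs , eq) = inj₂ (z , there z∈xs , eq)

  interleave-unique : ∀ {xs} → (∀ {x y} → f x ≡ f y → x ≡ y) →
                      (∀ {x y} → x ∈ xs → y ∈ xs → f x ≢ y) →
                      Unique xs → Unique (interleave xs)
  interleave-unique _ _ [] = []
  interleave-unique {x ∷ xs} f-inj disjoint (x∉xs ∷ unique) =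
      (x≢fx ∷ All.tabulate x≢) ∷ All.tabulate fx≢
    ∷ interleave-unique f-inj (λ p q → disjoint (there p) (there q)) unique
    where
    x≢fx : x ≢ f x
    x≢fx = disjoint (here refl) (here refl) ∘ sym
    x≢ : ∀ {v} → v ∈ interleave xs → x ≢ v
    x≢ v∈ with ∈-interleave⁻ xs v∈
    ... | inj₁ v∈xs = All.lookup x∉xs v∈xs
    ... | inj₂ (z , z∈xs , refl) = disjoint (there z∈xs) (here refl) ∘ sym
    fx≢ : ∀ {v} → v ∈ interleave xs → f x ≢ v
    fx≢ v∈ with ∈-interleave⁻ xs v∈
    ... | inj₁ v∈xs = disjoint (here refl) (there v∈xs)
    ... | inj₂ (z , z∈xs , refl) = λ fx≡fz → All.lookup x∉xs z∈xs (f-inj fx≡fz)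

closedWalk? : ∀ {A : Set} {R : A → A → Set} → (∀ x y → Dec (R x y)) → Decidable (ClosedWalk R)
closedWalk? R? []       = yes tt
closedWalk? R? (x ∷ xs) = linked? R? (x ∷ xs ++ [ x ])

module Enumeration (m : ℕ) .{{_ : NonZero m}} where

  open ZMod m

  _≟ℍ_ : DecidableEquality ℍ
  quat a b c d ≟ℍ quat a′ b′ c′ d′ with a Fin.≟ a′ | b Fin.≟ b′ | c Fin.≟ c′ | d Fin.≟ d′
  ... | yes refl | yes refl | yes refl | yes refl = yes refl
  ... | no a≢a′ | _ | _ | _ = no (a≢a′ ∘ cong ℍ.a₁)
  ... | yes _ | no b≢b′ | _ | _ = no (b≢b′ ∘ cong ℍ.a₂)
  ... | yes _ | yes _ | no c≢c′ | _ = no (c≢c′ ∘ cong ℍ.a₃)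
  ... | yes _ | yes _ | yes _ | no d≢d′ = no (d≢d′ ∘ cong ℍ.a₄)

  vertex? : Decidable ΦVertex
  vertex? x = ¬? (x ≟ℍ 0ℍ) ×-dec ¬? (x ≟ℍ 1ℍ) ×-dec ¬? (x ≟ℍ -1ℍ)

  adjacent? : ∀ x y → Dec (ΦAdj x y)
  adjacent? x y = ¬? ((x *ℍ y) ≟ℍ 0ℍ) ⊎-dec ¬? ((y *ℍ x) ≟ℍ 0ℍ)

  private
    pairs : List (Z × Z)
    pairs = cartesianProduct (allFin m) (allFin m)

    fromPairs : Z × Z → Z × Z → ℍ
    fromPairs (a , b) (c , d) = quat a b c d

    fromPairs-injective : ∀ {w x y z} → fromPairs w y ≡ fromPairs x z → w ≡ x × y ≡ z
    fromPairs-injective {_ , _} {_ , _} {_ , _} {_ , _} refl = refl , refl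

  elements : List ℍ
  elements = cartesianProductWith fromPairs pairs pairs

  ∈-elements : ∀ x → x ∈ elements
  ∈-elements (quat a b c d) = ∈.∈-cartesianProductWith⁺ fromPairs
    (∈.∈-cartesianProduct⁺ (∈.∈-allFin a) (∈.∈-allFin b))
    (∈.∈-cartesianProduct⁺ (∈.∈-allFin c) (∈.∈-allFin d))

  elements-unique : Unique elements
  elements-unique = Unique.cartesianProductWith⁺ fromPairs fromPairs-injective pairs-unique pairs-unique
    where
    pairs-unique : Unique pairs
    pairs-unique = Unique.cartesianProduct⁺ (Unique.allFin⁺ m) (Unique.allFin⁺ m)

module Cycle (k : ℕ) where

  private
    n m : ℕ
    n = suc (suc k)
    m = 2 ^ n
    instance
      _ = ℕP.m^n≢0 2 n

  open ZMod m
  open ℍ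
  open Congruence m
  open Reduction m
  open PowerOfTwo n
  open Enumeration m

  2∣m : 2 ℕ∣.∣ m
  2∣m = ℕ∣.divides (2 ^ suc k) (ℕP.*-comm 2 (2 ^ suc k))

  2<m : 2 < m
  2<m = ℕP.≤-trans (s≤s (s≤s (s≤s z≤n))) (ℕP.*-monoʳ-≤ 2 (ℕP.*-monoʳ-≤ 2 (ℕP.m^n>0 2 k)))

  1<m : 1 < m
  1<m = ℕP.<-trans (s≤s (s≤s z≤n)) 2<m

  ι-1 : ι 1ₘ ≡ + 1
  ι-1 = cong +_ (toℕ-1ₘ 1<m)

  ≈-2⇒≢0ₘ : ∀ {a} → ι a ≈ - + 2 → a ≢ 0ₘ
  ≈-2⇒≢0ₘ a≈-2 refl with ∣∧small⇒≡0 (_≈_.∣-difference (subst (_≈ - + 2) ι-0 a≈-2)) 2<m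
  ... | ()

  1ₘ≢0ₘ : 1ₘ ≢ 0ₘ
  1ₘ≢0ₘ e = ℕP.0≢1+n (trans (sym toℕ-0ₘ) (trans (cong toℕ (sym e)) (toℕ-1ₘ 1<m)))

  s y₀ : ℍ
  s  = decr -1ℍ
  y₀ = quat 1ₘ 1ₘ 0ₘ 0ₘ

  even-s : Even s
  even-s = odd-incr⇒even 2∣m (subst Odd (sym (incr-decr -1ℍ)) (odd--1ℍ 2∣m))

  ι-s : ι (a₁ s) ≈ - + 2
  ι-s = ι-- (ι-neg (≈-reflexive ι-1)) (≈-reflexive ι-1)

  s≢0ℍ : s ≢ 0ℍ
  s≢0ℍ = ≈-2⇒≢0ₘ ι-s ∘ cong a₁

  s*y₀≢0ℍ : s *ℍ y₀ ≢ 0ℍ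
  s*y₀≢0ℍ = ≈-2⇒≢0ₘ (≈-trans (_≋_.≈q₁ (lift-*ℍ s y₀)) first) ∘ cong a₁
    where
    simplify : ∀ x → x * + 1 - + 0 * + 1 - + 0 * + 0 - + 0 * + 0 ≡ x
    simplify = solve-∀
    first : ι (a₁ s) * ι 1ₘ - ι 0ₘ * ι 1ₘ - ι 0ₘ * ι 0ₘ - ι 0ₘ * ι 0ₘ ≈ - + 2
    first = ≈-trans (≈-reflexive (trans (cong₂ (λ z o → ι (a₁ s) * o - z * o - z * z - z * z) ι-0 ι-1)
                                        (simplify (ι (a₁ s)))))
                    ι-s

  even-vertex : ∀ {x} → Even x → x ≢ 0ℍ → ΦVertex x
  even-vertex ev x≢0 = x≢0 , even≢odd ev (odd-1ℍ 2∣m) , even≢odd ev (odd--1ℍ 2∣m)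

  Stem : ℍ → Set
  Stem x = Even x × x ≢ 0ℍ × x ≢ s

  stem-vertex : ∀ {x} → Stem x → ΦVertex x
  stem-vertex (ev , x≢0 , _) = even-vertex ev x≢0

  incr-stem-vertex : ∀ {x} → Stem x → ΦVertex (incr x)
  incr-stem-vertex (ev , x≢0 , x≢s) =
      even≢odd even-0ℍ (even⇒odd-incr 2∣m ev) ∘ sym
    , x≢0 ∘ incr-injective ∘ (λ e → trans e (sym incr-0ℍ))
    , x≢s ∘ incr-injective ∘ (λ e → trans e (sym (incr-decr -1ℍ)))

  stem-y₀ : Stem y₀
  stem-y₀ = even (cong₂ (λ a b → (a ℕ.+ a ℕ.+ b ℕ.+ b) % 2) (toℕ-1ₘ 1<m) toℕ-0ₘ)
          , 1ₘ≢0ₘ ∘ cong a₁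
          , 1ₘ≢0ₘ ∘ cong a₂

  rest? : Decidable (λ x → Stem x × x ≢ y₀)
  rest? x = (even? x ×-dec ¬? (x ≟ℍ 0ℍ) ×-dec ¬? (x ≟ℍ s)) ×-dec ¬? (x ≟ℍ y₀)

  rest stems cycle : List ℍ
  rest  = filter rest? elements
  stems = y₀ ∷ rest
  cycle = s ∷ interleave incr stems

  ∈-rest⁻ : ∀ {v} → v ∈ rest → Stem v × v ≢ y₀
  ∈-rest⁻ = proj₂ ∘ ∈.∈-filter⁻ rest? {xs = elements}

  ∈-stems⁻ : ∀ {v} → v ∈ stems → Stem v
  ∈-stems⁻ (here refl) = stem-y₀
  ∈-stems⁻ (there v∈)  = proj₁ (∈-rest⁻ v∈)

  ∈-stems⁺ : ∀ {v} → Stem v → v ∈ stems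
  ∈-stems⁺ {v} stem with v ≟ℍ y₀
  ... | yes v≡y₀ = here v≡y₀
  ... | no v≢y₀  = there (∈.∈-filter⁺ rest? (∈-elements v) (stem , v≢y₀))

  cycle-vertices : All ΦVertex cycle
  cycle-vertices = even-vertex even-s s≢0ℍ ∷ All.tabulate vertex
    where
    vertex : ∀ {v} → v ∈ interleave incr stems → ΦVertex v
    vertex v∈ with ∈-interleave⁻ incr stems v∈
    ... | inj₁ v∈stems = stem-vertex (∈-stems⁻ v∈stems)
    ... | inj₂ (z , z∈stems , refl) = incr-stem-vertex (∈-stems⁻ z∈stems)

  cycle-unique : Unique cycle
  cycle-unique = All.tabulate s≢ ∷ interleave-unique incr incr-injective incr≢ stems-unique
    where
    incr≢ : ∀ {x y} → x ∈ stems → y ∈ stems → incr x ≢ y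
    incr≢ x∈ y∈ = even≢odd (proj₁ (∈-stems⁻ y∈)) (even⇒odd-incr 2∣m (proj₁ (∈-stems⁻ x∈))) ∘ sym
    s≢ : ∀ {v} → v ∈ interleave incr stems → s ≢ v
    s≢ v∈ with ∈-interleave⁻ incr stems v∈
    ... | inj₁ v∈stems = proj₂ (proj₂ (∈-stems⁻ v∈stems)) ∘ sym
    ... | inj₂ (z , z∈stems , refl) = even≢odd even-s (even⇒odd-incr 2∣m (proj₁ (∈-stems⁻ z∈stems)))
    stems-unique : Unique stems
    stems-unique = All.tabulate (λ v∈ → proj₂ (∈-rest⁻ v∈) ∘ sym) ∷ Unique.filter⁺ rest? elements-unique

  cycle-complete : ∀ x → ΦVertex x → x ∈ cycle
  cycle-complete x (x≢0 , x≢1 , x≢-1) with even-or-odd x | x ≟ℍ s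
  ... | inj₁ _  | yes refl = here refl
  ... | inj₁ ev | no x≢s   = there (∈-interleave⁺ˡ incr (∈-stems⁺ (ev , x≢0 , x≢s)))
  ... | inj₂ od | _        = there (subst (_∈ interleave incr stems) (incr-decr x) (∈-interleave⁺ʳ incr (∈-stems⁺ stem)))
    where
    stem : Stem (decr x)
    stem = odd-incr⇒even 2∣m (subst Odd (sym (incr-decr x)) od)
         , (λ e → x≢1 (trans (sym (incr-decr x)) (trans (cong incr e) incr-0ℍ)))
         , (λ e → x≢-1 (trans (sym (incr-decr x)) (trans (cong incr e) (incr-decr -1ℍ))))

  walk : ∀ {x} xs → Stem x → All Stem xs → Linked ΦAdj (interleave incr (x ∷ xs) ++ [ s ])
  walk [] (ev , x≢0 , _) [] =
    odd-adjacentʳ (even⇒odd-incr 2∣m ev) x≢0 ∷ odd-adjacentˡ (even⇒odd-incr 2∣m ev) s≢0ℍ ∷ [-]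
  walk (_ ∷ xs) (ev , x≢0 , _) (stem′@(_ , x′≢0 , _) ∷ stems′) =
    odd-adjacentʳ (even⇒odd-incr 2∣m ev) x≢0 ∷ odd-adjacentˡ (even⇒odd-incr 2∣m ev) x′≢0 ∷ walk xs stem′ stems′

  hamiltonian : Φℍ2^-Hamiltonian n
  hamiltonian = cycle , cycle-vertices , cycle-unique , cycle-complete , s≤s (s≤s (s≤s z≤n))
              , inj₁ s*y₀≢0ℍ ∷ walk rest stem-y₀ (All.tabulate (proj₁ ∘ ∈-rest⁻))

-- The Hamiltonian cycle for 2^n = 2, checked by evaluation

module OrderTwo where

  open ZMod 2
  open Reduction 2
  open Enumeration 2
  open import Data.List.Membership.DecPropositional _≟ℍ_ using (_∈?_)
  open import Data.List.Relation.Unary.Unique.DecPropositional _≟ℍ_ using (unique?)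

  cycle : List ℍ
  cycle = interleave incr (filter (λ x → even? x ×-dec ¬? (x ≟ℍ 0ℍ)) elements)

  cycle-complete : ∀ x → ΦVertex x → x ∈ cycle
  cycle-complete x vertex
    with All.lookup (from-yes (all? (λ y → ¬? (vertex? y) ⊎-dec (y ∈? cycle)) elements)) (∈-elements x)
  ... | inj₁ ¬vertex = contradiction vertex ¬vertex
  ... | inj₂ x∈      = x∈

  hamiltonian : Φℍ2^-Hamiltonian 1
  hamiltonian = cycle , from-yes (all? vertex? cycle) , from-yes (unique? cycle) , cycle-complete
              , s≤s (s≤s (s≤s z≤n)) , from-yes (closedWalk? adjacent? cycle)

theorem4p6 : (n : ℕ) → 1 ≤ n → Φℍ2^-Hamiltonian n
theorem4p6 zero          ()
theorem4p6 (suc zero)    _ = OrderTwo.hamiltonian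
theorem4p6 (suc (suc k)) _ = Cycle.hamiltonian k
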